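{- For every integer $k\ge 3$, the prism $P_k=C_k\times K_2$ has Frank number $2$.
   Context: The prism $P_k$ consists of two cycles $v_1\cdots v_k$ and $u_1\cdots u_k$ together with the edges $u_iv_i$, $1\le i\le k$. An orientation of a graph replaces each edge $uv$ by exactly one of the arcs $(u,v)$, $(v,u)$. An oriented graph is strongly connected if for any two vertices $x,y$ there is a directed $(x,y)$-path. In an orientation $O$ of $G$, an edge $e$ is deletable if $O-e$ is strongly connected. For a $3$-edge-connected graph $G$, the Frank number $F(G)$ is the minimum $k$ such that $G$ admits $k$ orientations with the property that every edge of $G$ is deletable in at least one of them. -}

module Defs where

open import Data.Nat using (ℕ; zero; suc; _<_; _%_)
open import Data.Nat.DivMod using (m%n<n)
open import Data.Fin using (Fin; toℕ; fromℕ<)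
open import Data.Bool using (Bool; true; false)
open import Data.Product using (Σ; _×_; _,_; proj₁; proj₂; ∃-syntax)
open import Relation.Binary.PropositionalEquality using (_≡_)
open import Relation.Nullary using (¬_)
open import Relation.Binary.Construct.Closure.ReflexiveTransitive using (Star)

-- A finite (multi)graph given by a vertex type, an edge type and the two
-- ends of each edge (an edge is stored with an arbitrary reference direction).
record Graph : Set₁ where
  field
    V    : Set
    E    : Set
    ends : E → V × V
open Graph public

-- An orientation chooses, for each edge, one of its two possible arcs:
-- true  = arc (proj₁ (ends e), proj₂ (ends e)),
-- false = arc (proj₂ (ends e), proj₁ (ends e)).
Orientation : Graph → Set
Orientation G = E G → Bool

tail head : (G : Graph) → Orientation G → E G → V G
tail G O e with O e
... | true  = proj₁ (ends G e)
... | false = proj₂ (ends G e)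
head G O e with O e
... | true  = proj₂ (ends G e)
... | false = proj₁ (ends G e)

ArcWithout : (G : Graph) → Orientation G → E G → V G → V G → Set
ArcWithout G O d x y =
  Σ (E G) λ e → ¬ (e ≡ d) × (tail G O e ≡ x) × (head G O e ≡ y)

StronglyConnectedWithout : (G : Graph) → Orientation G → E G → Set
StronglyConnectedWithout G O d = ∀ x y → Star (ArcWithout G O d) x y

Deletable : (G : Graph) → Orientation G → E G → Set
Deletable G O e = StronglyConnectedWithout G O e

GoodFamily : (G : Graph) → ℕ → Set
GoodFamily G m = Σ (Fin m → Orientation G) λ Os → ∀ e → ∃[ i ] Deletable G (Os i) e

FrankNumberIs : Graph → ℕ → Set
FrankNumberIs G f = GoodFamily G f × (∀ m → m < f → ¬ GoodFamily G m)

cycSuc : ∀ {k} → Fin k → Fin k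
cycSuc {suc n} i = fromℕ< (m%n<n (suc (toℕ i)) (suc n))

data PrismEdge (k : ℕ) : Set where
  rim   : Fin k → Bool → PrismEdge k   -- rim i false = v_i v_{i+1}, rim i true = u_i u_{i+1}
  spoke : Fin k → PrismEdge k          -- spoke i = u_i v_i

-- Prism P_k: vertices (i , false) = v_i and (i , true) = u_i.
Prism : ℕ → Graph
Prism k = record
  { V    = Fin k × Bool
  ; E    = PrismEdge k
  ; ends = λ { (rim i b) → ((i , b) , (cycSuc i , b))
             ; (spoke i) → ((i , true) , (i , false)) } }

module Submission where

-- Lower bound: if every edge were deletable in a single orientation, then at a
-- vertex v of degree three deleting an edge leaves an arc entering v, and
-- deleting that arc leaves a second one; likewise for leaving arcs.  So v would
-- carry four distinct edges.
--
-- Upper bound: in the first orientation every square v_i v_{i+1} u_{i+1} u_i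
-- (i < k - 1) is a directed 4-cycle, and chaining squares around the prism
-- survives the loss of any rim edge away from index 0.  In the second both rims
-- are directed cycles, in opposite senses, joined by spokes in both
-- directions; it survives the loss of any spoke and of both rim edges at 0.
-- Only for k = 3 does the spoke at 0 need the first orientation.

open import Defs
open import Data.Nat as ℕ using (ℕ; zero; suc; _≤_; _<_; s≤s; z≤n)
import Data.Nat.Properties as ℕ
open import Data.Nat.DivMod using (m<n⇒m%n≡m; n%n≡0)
open import Data.Fin using (Fin; zero; suc; toℕ; fromℕ; inject₁)
import Data.Fin as Fin
open import Data.Fin.Properties
  using (toℕ-injective; toℕ-fromℕ<; toℕ-fromℕ; toℕ-inject₁; toℕ<n; <⇒≢; <-trans; ≤-refl; ≤̄⇒inject₁<; pigeonhole)
open import Data.Fin.Induction using (<-weakInduction; <-weakInduction-startingFrom; >-weakInduction)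
open import Data.Fin.Relation.Unary.Top using (view; ‵fromℕ; ‵inject₁)
open import Data.Bool using (Bool; true; false; not)
open import Data.Product using (Σ; _×_; _,_; proj₁; proj₂; ∃; ∃₂; ∃-syntax)
open import Data.Sum using (_⊎_; inj₁; inj₂)
open import Data.Empty using (⊥-elim)
open import Function using (_∘_; id; flip)
open import Relation.Nullary using (¬_)
open import Relation.Binary using (Rel)
open import Relation.Binary.PropositionalEquality
open import Relation.Binary.Construct.Closure.ReflexiveTransitive using (Star; ε; _◅_; _◅◅_; gmap; reverse)

cycSuc-inject₁ : ∀ {n} (i : Fin n) → cycSuc (inject₁ i) ≡ suc i
cycSuc-inject₁ {n} i = toℕ-injective (begin
  toℕ (cycSuc (inject₁ i))        ≡⟨ toℕ-fromℕ< _ ⟩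
  suc (toℕ (inject₁ i)) ℕ.% suc n ≡⟨ cong (λ m → suc m ℕ.% suc n) (toℕ-inject₁ i) ⟩
  suc (toℕ i) ℕ.% suc n           ≡⟨ m<n⇒m%n≡m (s≤s (toℕ<n i)) ⟩
  suc (toℕ i)                     ∎)
  where open ≡-Reasoning

cycSuc-fromℕ : ∀ n → cycSuc (fromℕ n) ≡ zero
cycSuc-fromℕ n = toℕ-injective (begin
  toℕ (cycSuc (fromℕ n))        ≡⟨ toℕ-fromℕ< _ ⟩
  suc (toℕ (fromℕ n)) ℕ.% suc n ≡⟨ cong (λ m → suc m ℕ.% suc n) (toℕ-fromℕ n) ⟩
  suc n ℕ.% suc n               ≡⟨ n%n≡0 (suc n) ⟩
  0                             ∎)
  where open ≡-Reasoning

cycSuc≡zero⇒≡fromℕ : ∀ {n} (i : Fin (suc n)) → cycSuc i ≡ zero → i ≡ fromℕ n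
cycSuc≡zero⇒≡fromℕ i eq with view i
... | ‵fromℕ     = refl
... | ‵inject₁ j with () ← trans (sym (cycSuc-inject₁ j)) eq

cycSuc≢id : ∀ {n} (i : Fin (suc (suc n))) → cycSuc i ≢ i
cycSuc≢id i eq with view i
... | ‵fromℕ     with () ← trans (sym (cycSuc-fromℕ _)) eq
... | ‵inject₁ j = ℕ.1+n≢n (trans (cong toℕ (trans (sym (cycSuc-inject₁ j)) eq)) (toℕ-inject₁ j))

module CyclicWalk {n ℓ} (R : Rel (Fin (suc (suc n))) ℓ) where

  module _ (step : ∀ i → i ≢ zero → R i (cycSuc i)) where

    private
      step-inject₁ : ∀ (i : Fin (suc n)) → inject₁ i ≢ zero → R (inject₁ i) (suc i)
      step-inject₁ i i≢0 = subst (R (inject₁ i)) (cycSuc-inject₁ i) (step (inject₁ i) i≢0)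

    walk-to-zero : ∀ j → Star R j zero
    walk-to-zero = >-weakInduction (λ j → Star R j zero) wrap inward
      where
      wrap : Star R (fromℕ (suc n)) zero
      wrap = subst (R (fromℕ (suc n))) (cycSuc-fromℕ (suc n)) (step _ λ ()) ◅ ε
      inward : ∀ i → Star R (suc i) zero → Star R (inject₁ i) zero
      inward zero    _ = ε
      inward (suc i) p = step-inject₁ (suc i) (λ ()) ◅ p

    walk-from-one : ∀ (j : Fin (suc n)) → Star R (suc zero) (suc j)
    walk-from-one j = <-weakInduction-startingFrom (Star R (suc zero)) ε outward (s≤s z≤n)
      where
      outward : ∀ i → Star R (suc zero) (inject₁ i) → Star R (suc zero) (suc i)
      outward zero    _ = ε
      outward (suc i) p = p ◅◅ (step-inject₁ (suc i) (λ ()) ◅ ε)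

  walk-around : (∀ i → R i (cycSuc i)) → ∀ i j → Star R i j
  walk-around step i j = walk-to-zero (λ i _ → step i) i ◅◅ from-zero j
    where
    from-zero : ∀ j → Star R zero j
    from-zero zero    = ε
    from-zero (suc j) = subst (R zero) (cycSuc-inject₁ zero) (step zero) ◅ walk-from-one (λ i _ → step i) j

cyclicInduction : ∀ {n ℓ} (P : Fin (suc n) → Set ℓ) (c : Fin (suc n)) → P zero →
                  (∀ i → inject₁ i ≢ c → P (inject₁ i) → P (suc i)) →
                  (∀ i → inject₁ i ≢ c → P (suc i) → P (inject₁ i)) →
                  (fromℕ n ≢ c → P zero → P (fromℕ n)) →
                  ∀ j → P j
cyclicInduction {n} P c P₀ up down wrap j with ℕ.≤-<-connex (toℕ j) (toℕ c)
... | inj₁ j≤c = <-weakInduction (λ j → j Fin.≤ c → P j) (λ _ → P₀) upTo j j≤c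
  where
  upTo : ∀ i → (inject₁ i Fin.≤ c → P (inject₁ i)) → suc i Fin.≤ c → P (suc i)
  upTo i P↑ i<c = up i (<⇒≢ i′<c) (P↑ (ℕ.<⇒≤ i′<c))
    where
    i′<c : inject₁ i Fin.< c
    i′<c = subst (ℕ._< toℕ c) (sym (toℕ-inject₁ i)) i<c
... | inj₂ c<j = >-weakInduction (λ j → c Fin.< j → P j) (λ c<n → wrap (<⇒≢ c<n ∘ sym) P₀) downTo j c<j
  where
  downTo : ∀ i → (c Fin.< suc i → P (suc i)) → c Fin.< inject₁ i → P (inject₁ i)
  downTo i P↓ c<i = down i (<⇒≢ c<i ∘ sym) (P↓ (<-trans c<i (≤̄⇒inject₁< ≤-refl)))

module Reachability (G : Graph) (O : Orientation G) (d : E G) where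

  infix 4 _⇝_ _⇄_

  Arc : V G → V G → Set
  Arc = ArcWithout G O d

  _⇝_ : V G → V G → Set
  _⇝_ = Star Arc

  _⇄_ : V G → V G → Set
  x ⇄ y = x ⇝ y × y ⇝ x

  ⇄-refl : ∀ {x} → x ⇄ x
  ⇄-refl = ε , ε

  ⇄-sym : ∀ {x y} → x ⇄ y → y ⇄ x
  ⇄-sym (p , q) = q , p

  ⇄-trans : ∀ {x y z} → x ⇄ y → y ⇄ z → x ⇄ z
  ⇄-trans (p , q) (p′ , q′) = p ◅◅ p′ , q′ ◅◅ q

  ⇄-cycle₄ : ∀ {x₁ x₂ x₃ x₄} → Arc x₁ x₂ → Arc x₂ x₃ → Arc x₃ x₄ → Arc x₄ x₁ →
             x₁ ⇄ x₂ × x₁ ⇄ x₃ × x₁ ⇄ x₄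
  ⇄-cycle₄ a b c e = (a ◅ ε , b ◅ c ◅ e ◅ ε) , (a ◅ b ◅ ε , c ◅ e ◅ ε) , (a ◅ b ◅ c ◅ ε , e ◅ ε)

  ⇄-root⇒stronglyConnected : ∀ r → (∀ x → r ⇄ x) → StronglyConnectedWithout G O d
  ⇄-root⇒stronglyConnected r joined x y = proj₂ (joined x) ◅◅ proj₁ (joined y)

  arcAlong : ∀ e → O e ≡ true → e ≢ d → Arc (proj₁ (ends G e)) (proj₂ (ends G e))
  arcAlong e Oe e≢d = e , e≢d , tail≡ , head≡
    where
    tail≡ : tail G O e ≡ proj₁ (ends G e)
    tail≡ rewrite Oe = refl
    head≡ : head G O e ≡ proj₂ (ends G e)
    head≡ rewrite Oe = refl

  arcAgainst : ∀ e → O e ≡ false → e ≢ d → Arc (proj₂ (ends G e)) (proj₁ (ends G e))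
  arcAgainst e Oe e≢d = e , e≢d , tail≡ , head≡
    where
    tail≡ : tail G O e ≡ proj₂ (ends G e)
    tail≡ rewrite Oe = refl
    head≡ : head G O e ≡ proj₁ (ends G e)
    head≡ rewrite Oe = refl

-- A vertex of degree three forces a second orientation

module _ (G : Graph) where

  Incident : V G → E G → Set
  Incident v e = proj₁ (ends G e) ≡ v ⊎ proj₂ (ends G e) ≡ v

  Loopless : Set
  Loopless = ∀ e → proj₁ (ends G e) ≢ proj₂ (ends G e)

  DegreeAtMost : ℕ → V G → Set
  DegreeAtMost m v = Σ (Fin m → E G) λ es → ∀ e → Incident v e → ∃ λ i → es i ≡ e

  incident-pigeonhole : ∀ {m n v} → m < n → DegreeAtMost m v →
                        (edge : Fin n → E G) → (∀ i → Incident v (edge i)) →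
                        ∃₂ λ i j → i Fin.< j × edge i ≡ edge j
  incident-pigeonhole m<n (es , covered) edge incident =
    let i , j , i<j , tagᵢ≡tagⱼ = pigeonhole m<n tag in
    i , j , i<j , (begin
      edge i       ≡⟨ sym (proj₂ (covered (edge i) (incident i))) ⟩
      es (tag i)   ≡⟨ cong es tagᵢ≡tagⱼ ⟩
      es (tag j)   ≡⟨ proj₂ (covered (edge j) (incident j)) ⟩
      edge j       ∎)
    where
    open ≡-Reasoning
    tag : Fin _ → Fin _
    tag i = proj₁ (covered (edge i) (incident i))

lastStep : ∀ {a ℓ} {A : Set a} {T : Rel A ℓ} {x y} → Star T x y → x ≡ y ⊎ ∃ λ z → T z y
lastStep ε = inj₁ refl
lastStep (t ◅ ts) with lastStep ts
... | inj₁ refl = inj₂ (_ , t)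
... | inj₂ p    = inj₂ p

module _ {G : Graph} (O : Orientation G) where

  tail-incident : ∀ e → Incident G (tail G O e) e
  tail-incident e with O e
  ... | true  = inj₁ refl
  ... | false = inj₂ refl

  head-incident : ∀ e → Incident G (head G O e) e
  head-incident e with O e
  ... | true  = inj₂ refl
  ... | false = inj₁ refl

  tail≢head : Loopless G → ∀ e → tail G O e ≢ head G O e
  tail≢head loopless e with O e
  ... | true  = loopless e
  ... | false = loopless e ∘ sym

  entering : ∀ {d v w} → StronglyConnectedWithout G O d → w ≢ v → ∃ λ e → e ≢ d × head G O e ≡ v
  entering {v = v} {w} sc w≢v with lastStep (sc w v)
  ... | inj₁ w≡v                         = ⊥-elim (w≢v w≡v)
  ... | inj₂ (_ , e , e≢d , _ , head≡v) = e , e≢d , head≡v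

  leaving : ∀ {d v w} → StronglyConnectedWithout G O d → v ≢ w → ∃ λ e → e ≢ d × tail G O e ≡ v
  leaving {v = v} {w} sc v≢w with sc v w
  ... | ε                             = ⊥-elim (v≢w refl)
  ... | (e , e≢d , tail≡v , _) ◅ _ = e , e≢d , tail≡v

  module _ (deletable : ∀ e → Deletable G O e) {v w : V G} (v≢w : v ≢ w) (e₀ : E G) where

    twoEntering : ∃₂ λ e e′ → e′ ≢ e × head G O e ≡ v × head G O e′ ≡ v
    twoEntering with entering (deletable e₀) (v≢w ∘ sym)
    ... | e , _ , e↓ with entering (deletable e) (v≢w ∘ sym)
    ... | e′ , e′≢e , e′↓ = e , e′ , e′≢e , e↓ , e′↓

    twoLeaving : ∃₂ λ e e′ → e′ ≢ e × tail G O e ≡ v × tail G O e′ ≡ v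
    twoLeaving with leaving (deletable e₀) v≢w
    ... | e , _ , e↑ with leaving (deletable e) v≢w
    ... | e′ , e′≢e , e′↑ = e , e′ , e′≢e , e↑ , e′↑

  ¬everyEdgeDeletable : Loopless G → ∀ {v w} → v ≢ w → DegreeAtMost G 3 v → E G →
                        ¬ (∀ e → Deletable G O e)
  ¬everyEdgeDeletable loopless {v} v≢w degree e₀ deletable
    with twoEntering deletable v≢w e₀ | twoLeaving deletable v≢w e₀
  ... | e₁ , e₂ , e₂≢e₁ , e₁↓ , e₂↓ | e₃ , e₄ , e₄≢e₃ , e₃↑ , e₄↑
    = let i , j , i<j , edgeᵢ≡edgeⱼ = incident-pigeonhole G (ℕ.n<1+n 3) degree edge incident in
      distinct i j i<j edgeᵢ≡edgeⱼ
    where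
    edge : Fin 4 → E G
    edge zero                   = e₁
    edge (suc zero)             = e₂
    edge (suc (suc zero))       = e₃
    edge (suc (suc (suc zero))) = e₄

    incident : ∀ i → Incident G v (edge i)
    incident zero                   = subst (λ x → Incident G x e₁) e₁↓ (head-incident e₁)
    incident (suc zero)             = subst (λ x → Incident G x e₂) e₂↓ (head-incident e₂)
    incident (suc (suc zero))       = subst (λ x → Incident G x e₃) e₃↑ (tail-incident e₃)
    incident (suc (suc (suc zero))) = subst (λ x → Incident G x e₄) e₄↑ (tail-incident e₄)

    entering≢leaving : ∀ {e e′} → head G O e ≡ v → tail G O e′ ≡ v → e ≢ e′
    entering≢leaving {e} e↓ e↑ refl = tail≢head loopless e (trans e↑ (sym e↓))

    distinct : ∀ i j → i Fin.< j → edge i ≢ edge j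
    distinct zero             (suc zero)             _ = e₂≢e₁ ∘ sym
    distinct zero             (suc (suc zero))       _ = entering≢leaving e₁↓ e₃↑
    distinct zero             (suc (suc (suc zero))) _ = entering≢leaving e₁↓ e₄↑
    distinct (suc zero)       (suc (suc zero))       _ = entering≢leaving e₂↓ e₃↑
    distinct (suc zero)       (suc (suc (suc zero))) _ = entering≢leaving e₂↓ e₄↑
    distinct (suc (suc zero)) (suc (suc (suc zero))) _ = e₄≢e₃ ∘ sym
    distinct _                   zero                   ()
    distinct (suc _)             (suc zero)             (s≤s ())
    distinct (suc (suc _))       (suc (suc zero))       (s≤s (s≤s ()))
    distinct (suc (suc (suc _))) (suc (suc (suc zero))) (s≤s (s≤s (s≤s ())))

frankNumber≥2 : ∀ {G : Graph} → Loopless G → ∀ {v w} → v ≢ w → DegreeAtMost G 3 v → E G →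
                ∀ m → m < 2 → ¬ GoodFamily G m
frankNumber≥2 loopless v≢w degree e₀ zero       _ (Os , covered) with () ← proj₁ (covered e₀)
frankNumber≥2 loopless v≢w degree e₀ (suc zero) _ (Os , covered) =
  ¬everyEdgeDeletable (Os zero) loopless v≢w degree e₀ λ e → onlyOne (covered e)
  where
  onlyOne : ∀ {e} → ∃[ i ] Deletable _ (Os i) e → Deletable _ (Os zero) e
  onlyOne (zero , del) = del
frankNumber≥2 _ _ _ _ (suc (suc _)) (s≤s (s≤s ()))

rim-injective : ∀ {k} {i j : Fin k} {b c} → rim i b ≡ rim j c → i ≡ j
rim-injective refl = refl

spoke-injective : ∀ {k} {i j : Fin k} → spoke i ≡ spoke j → i ≡ j
spoke-injective refl = refl

prism-loopless : ∀ {n} → Loopless (Prism (suc (suc n)))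
prism-loopless (rim i b) eq = cycSuc≢id i (sym (cong proj₁ eq))
prism-loopless (spoke i) ()

prism-degree≤3 : ∀ {n} → DegreeAtMost (Prism (suc n)) 3 (zero , false)
prism-degree≤3 {n} = edges , covered
  where
  edges : Fin 3 → PrismEdge (suc n)
  edges zero             = rim zero false
  edges (suc zero)       = rim (fromℕ n) false
  edges (suc (suc zero)) = spoke zero
  covered : ∀ e → Incident (Prism (suc n)) (zero , false) e → ∃ λ i → edges i ≡ e
  covered (rim i b) (inj₁ refl) = zero , refl
  covered (rim i b) (inj₂ eq)   =
    suc zero , cong₂ rim (sym (cycSuc≡zero⇒≡fromℕ i (cong proj₁ eq))) (sym (cong proj₂ eq))
  covered (spoke i) (inj₂ refl) = suc (suc zero) , refl

module PrismReachability {n} (O : Orientation (Prism (suc n))) (d : PrismEdge (suc n)) where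

  open Reachability (Prism (suc n)) O d public

  root : Fin (suc n) × Bool
  root = zero , false

  Joined : Fin (suc n) → Set
  Joined j = ∀ b → root ⇄ (j , b)

  SquareLinked : Fin (suc n) → Set
  SquareLinked j = ∀ b → (j , false) ⇄ (j , b) × (j , false) ⇄ (cycSuc j , b)

  joined-forward : ∀ {j} → SquareLinked j → Joined j → Joined (cycSuc j)
  joined-forward square joined b = ⇄-trans (joined false) (proj₂ (square b))

  joined-backward : ∀ {j} → SquareLinked j → Joined (cycSuc j) → Joined j
  joined-backward square joined b =
    ⇄-trans (joined false) (⇄-trans (⇄-sym (proj₂ (square false))) (proj₁ (square b)))

  joined⇒stronglyConnected : (∀ j → Joined j) → StronglyConnectedWithout (Prism (suc n)) O d
  joined⇒stronglyConnected joined = ⇄-root⇒stronglyConnected root λ (j , b) → joined j b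

-- First orientation: alternating squares

even : ∀ {k} → Fin k → Bool
even zero    = true
even (suc i) = not (even i)

even-inject₁ : ∀ {n} (i : Fin n) → even (inject₁ i) ≡ even i
even-inject₁ zero    = refl
even-inject₁ (suc i) = cong not (even-inject₁ i)

even-cycSuc-inject₁ : ∀ {n} (i : Fin n) → even (cycSuc (inject₁ i)) ≡ not (even (inject₁ i))
even-cycSuc-inject₁ i rewrite cycSuc-inject₁ i | even-inject₁ i = refl

-- Consecutive squares are directed 4-cycles of opposite senses; the square
-- across the seam k - 1, 0 is one only when k is even.
alternating : ∀ {k} → Orientation (Prism k)
alternating (rim i false) = even i
alternating (rim i true)  = not (even i)
alternating (spoke i)     = even i

module _ {n} (d : PrismEdge (suc n)) where

  open PrismReachability alternating d

  alternating-square : ∀ j → even (cycSuc j) ≡ not (even j) →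
                       (∀ b → rim j b ≢ d) → spoke j ≢ d → spoke (cycSuc j) ≢ d →
                       SquareLinked j
  alternating-square j parity rim≢d spoke≢d spoke′≢d with even j in eq
  ... | true
    with v⇄v′ , v⇄u′ , v⇄u ← ⇄-cycle₄ (arcAlong   (rim j false)        eq            (rim≢d false))
                                      (arcAgainst (spoke (cycSuc j)) parity        spoke′≢d)
                                      (arcAgainst (rim j true)         (cong not eq) (rim≢d true))
                                      (arcAlong   (spoke j)            eq            spoke≢d)
    = λ { false → ⇄-refl , v⇄v′ ; true → v⇄u , v⇄u′ }
  ... | false
    with v⇄u , v⇄u′ , v⇄v′ ← ⇄-cycle₄ (arcAgainst (spoke j)            eq            spoke≢d)
                                      (arcAlong   (rim j true)         (cong not eq) (rim≢d true))
                                      (arcAlong   (spoke (cycSuc j)) parity        spoke′≢d)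
                                      (arcAgainst (rim j false)        eq            (rim≢d false))
    = λ { false → ⇄-refl , v⇄v′ ; true → v⇄u , v⇄u′ }

  -- Without the spoke at cycSuc j, the square still gives the directed path
  -- u_{j+1} → u_j → v_j → v_{j+1}, whose ends are already joined.
  alternating-joined-backward : ∀ j → even j ≡ true → (∀ b → rim j b ≢ d) → spoke j ≢ d →
                                Joined (cycSuc j) → Joined j
  alternating-joined-backward j eq rim≢d spoke≢d joined = λ
    { true  → proj₁ (joined true) ◅◅ (u′→u ◅ ε) , u→v ◅ v→v′ ◅ proj₂ (joined false)
    ; false → proj₁ (joined true) ◅◅ (u′→u ◅ u→v ◅ ε) , v→v′ ◅ proj₂ (joined false) }
    where
    u′→u : Arc (cycSuc j , true) (j , true)
    u′→u = arcAgainst (rim j true) (cong not eq) (rim≢d true)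
    u→v : Arc (j , true) (j , false)
    u→v = arcAlong (spoke j) eq spoke≢d
    v→v′ : Arc (j , false) (cycSuc j , false)
    v→v′ = arcAlong (rim j false) eq (rim≢d false)

alternating-rim-deletable : ∀ {n} (c : Fin n) b → Deletable (Prism (suc n)) alternating (rim (suc c) b)
alternating-rim-deletable {suc n} c b =
  joined⇒stronglyConnected (cyclicInduction Joined (suc c) joined-zero up down wrap)
  where
  d : PrismEdge (suc (suc n))
  d = rim (suc c) b
  open PrismReachability alternating d

  rim≢d : ∀ {j} → j ≢ suc c → ∀ b′ → rim j b′ ≢ d
  rim≢d j≢c b′ = j≢c ∘ rim-injective

  square : ∀ j → j ≢ suc c → even (cycSuc j) ≡ not (even j) → SquareLinked j
  square j j≢c parity = alternating-square d j parity (rim≢d j≢c) (λ ()) (λ ())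

  inner : ∀ i → inject₁ i ≢ suc c → SquareLinked (inject₁ i)
  inner i i≢c = square (inject₁ i) i≢c (even-cycSuc-inject₁ i)

  joined-zero : Joined zero
  joined-zero b = proj₁ (inner zero (λ ()) b)

  up : ∀ i → inject₁ i ≢ suc c → Joined (inject₁ i) → Joined (suc i)
  up i i≢c joined = subst Joined (cycSuc-inject₁ i) (joined-forward (inner i i≢c) joined)

  down : ∀ i → inject₁ i ≢ suc c → Joined (suc i) → Joined (inject₁ i)
  down i i≢c joined = joined-backward (inner i i≢c) (subst Joined (sym (cycSuc-inject₁ i)) joined)

  seam : fromℕ (suc n) ≢ suc c → Joined (cycSuc (fromℕ (suc n))) → Joined (fromℕ (suc n))
  seam n≢c with even (fromℕ (suc n)) in eq
  ... | true  = alternating-joined-backward d _ eq (rim≢d n≢c) (λ ())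
  ... | false = joined-backward (square _ n≢c parity)
    where
    parity : even (cycSuc (fromℕ (suc n))) ≡ not (even (fromℕ (suc n)))
    parity = trans (cong even (cycSuc-fromℕ (suc n))) (cong not (sym eq))

  wrap : fromℕ (suc n) ≢ suc c → Joined zero → Joined (fromℕ (suc n))
  wrap n≢c = seam n≢c ∘ subst Joined (sym (cycSuc-fromℕ (suc n)))

-- Second orientation: two opposite rim cycles

-- The spokes at
-- 0 and 3 point from v to u and all others from u to v, so that for k ≥ 4 both
-- directions survive the deletion of any spoke, and the rim edges at index 0
-- find v_0 → u_0 and u_1 → v_1.
twoCycles : ∀ {k} → Orientation (Prism k)
twoCycles (rim i false)                  = true
twoCycles (rim i true)                   = false
twoCycles (spoke zero)                   = false
twoCycles (spoke (suc (suc (suc zero)))) = false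
twoCycles (spoke _)                      = true

module TwoCycles {n} (d : PrismEdge (suc (suc n))) where

  open PrismReachability twoCycles d public

  VArc UArc⁻¹ : Rel (Fin (suc (suc n))) _
  VArc i j   = ArcWithout (Prism (suc (suc n))) twoCycles d (i , false) (j , false)
  UArc⁻¹ i j = ArcWithout (Prism (suc (suc n))) twoCycles d (j , true) (i , true)

  v-step : ∀ {i} → rim i false ≢ d → VArc i (cycSuc i)
  v-step = arcAlong (rim _ false) refl

  u-step : ∀ {i} → rim i true ≢ d → UArc⁻¹ i (cycSuc i)
  u-step = arcAgainst (rim _ true) refl

  along-v : ∀ {i j} → Star VArc i j → (i , false) ⇝ (j , false)
  along-v = gmap (_, false) id

  along-u⁻¹ : ∀ {i j} → Star UArc⁻¹ i j → (j , true) ⇝ (i , true)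
  along-u⁻¹ = gmap (_, true) id ∘ reverse {T = UArc⁻¹} {U = flip UArc⁻¹} id

  v-around : (∀ i → rim i false ≢ d) → ∀ i j → (i , false) ⇝ (j , false)
  v-around rim≢d i j = along-v (CyclicWalk.walk-around VArc (v-step ∘ rim≢d) i j)

  u-around : (∀ i → rim i true ≢ d) → ∀ i j → (i , true) ⇝ (j , true)
  u-around rim≢d i j = along-u⁻¹ (CyclicWalk.walk-around UArc⁻¹ (u-step ∘ rim≢d) j i)

  v→u-at-zero : d ≢ spoke zero → (zero , false) ⇝ (zero , true)
  v→u-at-zero d≢s = arcAgainst (spoke zero) refl (d≢s ∘ sym) ◅ ε

  u→v-at-one : d ≢ spoke (suc zero) → (suc zero , true) ⇝ (suc zero , false)
  u→v-at-one d≢s = arcAlong (spoke (suc zero)) refl (d≢s ∘ sym) ◅ ε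

twoCycles-spoke-deletable : ∀ {n} (s s₁ s₂ : Fin (suc (suc n))) → s₁ ≢ s → s₂ ≢ s →
                            twoCycles (spoke s₁) ≡ false → twoCycles (spoke s₂) ≡ true →
                            Deletable (Prism (suc (suc n))) twoCycles (spoke s)
twoCycles-spoke-deletable s s₁ s₂ s₁≢s s₂≢s s₁-down s₂-up = joined⇒stronglyConnected joined
  where
  open TwoCycles (spoke s)
  v⇝ : ∀ i j → (i , false) ⇝ (j , false)
  v⇝ = v-around (λ _ ())
  u⇝ : ∀ i j → (i , true) ⇝ (j , true)
  u⇝ = u-around (λ _ ())
  v→u : Arc (s₁ , false) (s₁ , true)
  v→u = arcAgainst (spoke s₁) s₁-down (s₁≢s ∘ spoke-injective)
  u→v : Arc (s₂ , true) (s₂ , false)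
  u→v = arcAlong (spoke s₂) s₂-up (s₂≢s ∘ spoke-injective)
  joined : ∀ j → Joined j
  joined j false = v⇝ zero j , v⇝ j zero
  joined j true  = v⇝ zero s₁ ◅◅ v→u ◅ u⇝ s₁ j , u⇝ j s₂ ◅◅ u→v ◅ v⇝ s₂ zero

twoCycles-rim-zero-deletable : ∀ {n} b → Deletable (Prism (suc (suc n))) twoCycles (rim zero b)
twoCycles-rim-zero-deletable false = joined⇒stronglyConnected joined
  where
  open TwoCycles (rim zero false)
  u⇝ : ∀ i j → (i , true) ⇝ (j , true)
  u⇝ = u-around (λ _ ())
  v⇝zero : ∀ j → (j , false) ⇝ root
  v⇝zero j = along-v (CyclicWalk.walk-to-zero VArc (λ i i≢0 → v-step (i≢0 ∘ rim-injective)) j)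
  one⇝v : ∀ j → (suc zero , false) ⇝ (suc j , false)
  one⇝v j = along-v (CyclicWalk.walk-from-one VArc (λ i i≢0 → v-step (i≢0 ∘ rim-injective)) j)
  root⇝u : ∀ j → root ⇝ (j , true)
  root⇝u j = v→u-at-zero (λ ()) ◅◅ u⇝ zero j
  u⇝one : ∀ j → (j , true) ⇝ (suc zero , false)
  u⇝one j = u⇝ j (suc zero) ◅◅ u→v-at-one (λ ())
  joined : ∀ j → Joined j
  joined zero    false = ⇄-refl
  joined (suc j) false = root⇝u (suc zero) ◅◅ u→v-at-one (λ ()) ◅◅ one⇝v j , v⇝zero (suc j)
  joined j       true  = root⇝u j , u⇝one j ◅◅ v⇝zero (suc zero)
twoCycles-rim-zero-deletable true = joined⇒stronglyConnected joined
  where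
  open TwoCycles (rim zero true)
  v⇝ : ∀ i j → (i , false) ⇝ (j , false)
  v⇝ = v-around (λ _ ())
  zero⇝u : ∀ j → (zero , true) ⇝ (j , true)
  zero⇝u j = along-u⁻¹ (CyclicWalk.walk-to-zero UArc⁻¹ (λ i i≢0 → u-step (i≢0 ∘ rim-injective)) j)
  u⇝one : ∀ j → (j , true) ⇝ (suc zero , true)
  u⇝one zero    = zero⇝u (suc zero)
  u⇝one (suc j) = along-u⁻¹ (CyclicWalk.walk-from-one UArc⁻¹ (λ i i≢0 → u-step (i≢0 ∘ rim-injective)) j)
  joined : ∀ j → Joined j
  joined j false = v⇝ zero j , v⇝ j zero
  joined j true  = v→u-at-zero (λ ()) ◅◅ zero⇝u j , u⇝one j ◅◅ u→v-at-one (λ ()) ◅◅ v⇝ (suc zero) zero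

-- In P₃ the first orientation, less the spoke u_0 v_0, still contains the
-- Hamiltonian cycle v_0 v_1 u_1 u_0 u_2 v_2.
alternating-P₃-spoke-deletable : Deletable (Prism 3) alternating (spoke zero)
alternating-P₃-spoke-deletable = joined⇒stronglyConnected joined
  where
  open PrismReachability {2} alternating (spoke zero)
  v₀ v₁ v₂ u₀ u₁ u₂ : Fin 3 × Bool
  v₀ = zero , false
  v₁ = suc zero , false
  v₂ = suc (suc zero) , false
  u₀ = zero , true
  u₁ = suc zero , true
  u₂ = suc (suc zero) , true
  a₁ : Arc v₀ v₁
  a₁ = arcAlong (rim zero false) refl λ ()
  a₂ : Arc v₁ u₁
  a₂ = arcAgainst (spoke (suc zero)) refl λ ()
  a₃ : Arc u₁ u₀
  a₃ = arcAgainst (rim zero true) refl λ ()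
  a₄ : Arc u₀ u₂
  a₄ = arcAgainst (rim (suc (suc zero)) true) refl λ ()
  a₅ : Arc u₂ v₂
  a₅ = arcAlong (spoke (suc (suc zero))) refl λ ()
  a₆ : Arc v₂ v₀
  a₆ = arcAlong (rim (suc (suc zero)) false) refl λ ()
  joined : ∀ j → Joined j
  joined zero             false = ⇄-refl
  joined (suc zero)       false = a₁ ◅ ε , a₂ ◅ a₃ ◅ a₄ ◅ a₅ ◅ a₆ ◅ ε
  joined (suc zero)       true  = a₁ ◅ a₂ ◅ ε , a₃ ◅ a₄ ◅ a₅ ◅ a₆ ◅ ε
  joined zero             true  = a₁ ◅ a₂ ◅ a₃ ◅ ε , a₄ ◅ a₅ ◅ a₆ ◅ ε
  joined (suc (suc zero)) true  = a₁ ◅ a₂ ◅ a₃ ◅ a₄ ◅ ε , a₅ ◅ a₆ ◅ ε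
  joined (suc (suc zero)) false = a₁ ◅ a₂ ◅ a₃ ◅ a₄ ◅ a₅ ◅ ε , a₆ ◅ ε

orientations : ∀ {k} → Fin 2 → Orientation (Prism k)
orientations zero       = alternating
orientations (suc zero) = twoCycles

everyEdgeDeletable : ∀ m e → ∃[ i ] Deletable (Prism (3 ℕ.+ m)) (orientations i) e
everyEdgeDeletable m (rim zero b)    = suc zero , twoCycles-rim-zero-deletable b
everyEdgeDeletable m (rim (suc c) b) = zero , alternating-rim-deletable c b
everyEdgeDeletable zero (spoke zero) = zero , alternating-P₃-spoke-deletable
everyEdgeDeletable (suc m) (spoke zero) =
  suc zero , twoCycles-spoke-deletable zero (suc (suc (suc zero))) (suc zero) (λ ()) (λ ()) refl refl
everyEdgeDeletable m (spoke (suc zero)) =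
  suc zero , twoCycles-spoke-deletable (suc zero) zero (suc (suc zero)) (λ ()) (λ ()) refl refl
everyEdgeDeletable m (spoke (suc (suc s))) =
  suc zero , twoCycles-spoke-deletable (suc (suc s)) zero (suc zero) (λ ()) (λ ()) refl refl

lemma2p7 : (k : ℕ) → 3 ≤ k → FrankNumberIs (Prism k) 2
lemma2p7 (suc (suc (suc m))) _ =
  (orientations , everyEdgeDeletable m) ,
  frankNumber≥2 prism-loopless {w = zero , true} (λ ()) prism-degree≤3 (spoke zero)
lemma2p7 (suc zero)       (s≤s ())
lemma2p7 (suc (suc zero)) (s≤s (s≤s ()))
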